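{- There exists an almost periodic sequence $x$ over $\{0,1\}$ such that for every $n\in\mathbb{N}$ there is a prefix of $x$ in which the number of $0$'s exceeds the number of $1$'s by $n$, and for every $n\in\mathbb{N}$ there is a prefix of $x$ in which the number of $1$'s exceeds the number of $0$'s by $n$.
   Context: A sequence $x\colon\mathbb{N}\to A$ over a finite alphabet is almost periodic if for each finite word $u$ occurring in $x$ there is $l$ such that every segment $x(i)x(i+1)\dots x(i+l-1)$ of length $l$ contains an occurrence of $u$. A prefix of $x$ is a word $x(0)\dots x(i)$. -}

module Defs where

open import Data.Nat using (ℕ; zero; suc; _+_; _≤_; _<_)
open import Data.Fin using (Fin; toℕ)
open import Data.List using (List; length; lookup)
open import Data.Product using (Σ; ∃; _×_)
open import Relation.Binary.PropositionalEquality using (_≡_)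

OccursAt : {A : Set} → (ℕ → A) → List A → ℕ → Set
OccursAt x u i = (j : Fin (length u)) → x (i + toℕ j) ≡ lookup u j

Occurs : {A : Set} → (ℕ → A) → List A → Set
Occurs x u = ∃ λ i → OccursAt x u i

SegmentContains : {A : Set} → (ℕ → A) → ℕ → ℕ → List A → Set
SegmentContains x i l u = ∃ λ k → (k + length u ≤ l) × OccursAt x u (i + k)

AlmostPeriodic : {A : Set} → (ℕ → A) → Set
AlmostPeriodic x = (u : List _) → Occurs x u →
  ∃ λ l → (i : ℕ) → SegmentContains x i l u

open import Data.Fin using (_≟_)
open import Relation.Nullary using (yes; no)

count : (ℕ → Fin 2) → Fin 2 → ℕ → ℕ
count x a zero = zero
count x a (suc m) with x m ≟ a
... | yes _ = suc (count x a m)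
... | no _  = count x a m

module Submission where

-- The sequence x is determined by the two rules
--     x(2m) = m mod 2        x(2m+1) = 1 - x(m),
-- i.e. the even positions carry the alternating word 0101..., and the odd
-- positions carry the complement of x itself.
--
-- A sequence whose every prefix recurs with some positive
-- period (a Toeplitz-type sequence) is almost periodic: a word occurring before
-- position N reappears in every window of length P + N.  By induction on e,
-- the first 2^e letters of x recur with period 2^(e+2).
--
-- Let D(N) = #0 - #1 among the first N letters, an integer.
-- Splitting a prefix of length 2N into even and odd positions gives
--     D(2N) = [N odd] - D(N),
-- and appending a letter changes D by ±1.  Combining these, from an even
-- prefix length 2M with D = d one reaches prefix lengths with discrepancies
-- -d, 1+d, -(1+d) and 2+d.  Iterating from D(2) = 0 gives every integer as a
-- discrepancy; a conversion lemma turns D = ±n into the required counts.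

open import Defs
open import Data.Nat using (ℕ; zero; suc; _+_; _*_; _^_; _≤_; _<_; z≤n; s≤s)
open import Data.Nat.Properties
  using (≤-trans; <⇒≤; <-trans; n<1+n; n≤1+n; m≤m+n; m≤m*n; +-comm; +-suc; +-identityʳ;
         +-mono-≤; +-monoˡ-≤; +-monoʳ-<; *-comm; *-cancelʳ-<; *-monoˡ-<; m^n>0)
open import Data.Nat.Tactic.RingSolver using (solve-∀)
open import Data.Integer as ℤ using (ℤ)
import Data.Integer.Properties as ℤₚ
open import Data.Integer.Tactic.RingSolver renaming (solve-∀ to solve-∀ℤ)
open import Data.Fin using (Fin; zero; suc; toℕ; _≟_)
open import Data.Fin.Properties using (toℕ<n)
open import Data.List using (length; lookup)
open import Data.Product using (Σ; ∃; _×_; _,_)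
open import Function using (_∘_)
open import Relation.Nullary using (yes; no)
open import Relation.Binary.PropositionalEquality
  using (_≡_; refl; sym; trans; cong; cong₂; subst; module ≡-Reasoning)
open ≡-Reasoning

-- Toeplitz-type sequences are almost periodic

PeriodicBelow : {A : Set} → (ℕ → A) → ℕ → ℕ → Set
PeriodicBelow y N P = (n : ℕ) → n < N → (k : ℕ) → y (n + k * P) ≡ y n

ToeplitzType : {A : Set} → (ℕ → A) → Set
ToeplitzType y = (N : ℕ) → ∃ λ P → 0 < P × PeriodicBelow y N P

multipleAbove : (Q s : ℕ) → ∃ λ k → ∃ λ o → o ≤ suc Q × s + o ≡ k * suc Q
multipleAbove Q zero = 0 , 0 , z≤n , refl
multipleAbove Q (suc s) with multipleAbove Q s
... | k , suc o , o<P , s+o≡kP = k , o , <⇒≤ o<P , trans (sym (+-suc s o)) s+o≡kP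
... | k , zero , _ , s≡kP = suc k , Q , n≤1+n Q , cong suc (begin
  s + Q           ≡⟨ +-comm s Q ⟩
  Q + s           ≡⟨ cong (Q +_) (trans (sym (+-identityʳ s)) s≡kP) ⟩
  Q + k * suc Q   ∎)

-- A word occurring at i with period P for the first i + |u| letters occurs in
-- every window of length P + i + |u|: shift the occurrence to the first
-- multiple of P above the window start.
toeplitz⇒almostPeriodic : {A : Set} (y : ℕ → A) → ToeplitzType y → AlmostPeriodic y
toeplitz⇒almostPeriodic y toeplitz u (i , occ) with toeplitz (i + length u)
... | suc Q , _ , periodic = (suc Q + i) + length u , inWindow
  where
  regroup : ∀ s o i t → s + (o + i) + t ≡ i + t + (s + o)
  regroup = solve-∀

  inWindow : (s : ℕ) → SegmentContains y s ((suc Q + i) + length u) u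
  inWindow s with multipleAbove Q s
  ... | k , o , o≤P , s+o≡kP = o + i , +-monoˡ-≤ (length u) (+-monoˡ-≤ i o≤P) , shifted
    where
    shifted : OccursAt y u (s + (o + i))
    shifted j = begin
      y (s + (o + i) + toℕ j)    ≡⟨ cong y (trans (regroup s o i (toℕ j)) (cong (i + toℕ j +_) s+o≡kP)) ⟩
      y (i + toℕ j + k * suc Q)  ≡⟨ periodic (i + toℕ j) (+-monoʳ-< i (toℕ<n j)) k ⟩
      y (i + toℕ j)              ≡⟨ occ j ⟩
      lookup u j                 ∎

flip : Fin 2 → Fin 2
flip zero       = suc zero
flip (suc zero) = zero

flip-involutive : (a : Fin 2) → flip (flip a) ≡ a
flip-involutive zero       = refl
flip-involutive (suc zero) = refl

parity : ℕ → Fin 2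
parity zero    = zero
parity (suc n) = flip (parity n)

parity-even : (m : ℕ) → parity (m * 2) ≡ zero
parity-even zero    = refl
parity-even (suc m) = trans (flip-involutive _) (parity-even m)

parity-odd : (m : ℕ) → parity (suc (m * 2)) ≡ suc zero
parity-odd m = cong flip (parity-even m)

parity-periodic : (n k : ℕ) → parity (n + k * 2) ≡ parity n
parity-periodic zero    k = parity-even k
parity-periodic (suc n) k = cong flip (parity-periodic n k)

data HalfView : ℕ → Set where
  even : (m : ℕ) → HalfView (m * 2)
  odd  : (m : ℕ) → HalfView (suc (m * 2))

halfView : (n : ℕ) → HalfView n
halfView zero = even 0
halfView (suc n) with halfView n
... | even m = odd m
... | odd m  = even (suc m)

halfView-even : (m : ℕ) → halfView (m * 2) ≡ even m
halfView-even zero = refl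
halfView-even (suc m) rewrite halfView-even m = refl

halfView-odd : (m : ℕ) → halfView (suc (m * 2)) ≡ odd m
halfView-odd m rewrite halfView-even m = refl

-- The recursion x(2m+1) = flip (x m) runs on halves, so it is driven by fuel.
xFuel : ℕ → ℕ → Fin 2
xFuel zero    _ = zero
xFuel (suc f) n with halfView n
... | even m = parity m
... | odd m  = flip (xFuel f m)

x : ℕ → Fin 2
x n = xFuel (suc n) n

xFuel-stable : (f g n : ℕ) → n < f → n < g → xFuel f n ≡ xFuel g n
xFuel-stable (suc f) (suc g) n (s≤s n≤f) (s≤s n≤g) with halfView n
... | even m = refl
... | odd m  = cong flip (xFuel-stable f g m (m<1+2m n≤f) (m<1+2m n≤g))
  where
  m<1+2m : ∀ {h} → suc (m * 2) ≤ h → m < h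
  m<1+2m = ≤-trans (s≤s (m≤m*n m 2))

x-even : (m : ℕ) → x (m * 2) ≡ parity m
x-even m rewrite halfView-even m = refl

x-odd : (m : ℕ) → x (suc (m * 2)) ≡ flip (x m)
x-odd m rewrite halfView-odd m =
  cong flip (xFuel-stable (suc (m * 2)) (suc m) m (s≤s (m≤m*n m 2)) (n<1+n m))

-- x is almost periodic

n<2^n : (n : ℕ) → n < 2 ^ n
n<2^n zero    = s≤s z≤n
n<2^n (suc n) = +-mono-≤ (m^n>0 2 n) (≤-trans (n<2^n n) (m≤m+n _ 0))

half-< : (m b : ℕ) → suc (m * 2) < 2 * b → m < b
half-< m b h = *-cancelʳ-< 2 m b (subst (m * 2 <_) (*-comm 2 b) (<-trans (n<1+n (m * 2)) h))

-- The first 2^e letters of x recur with period 2^e * 4: even positions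
-- inherit the period 2 of parity, odd positions the period of x on halves.
x-periodic : (e : ℕ) → PeriodicBelow x (2 ^ e) (2 ^ e * 4)
x-periodic e n = periodicAt e (halfView n)
  where
  periodicAt : (e : ℕ) {n : ℕ} → HalfView n → n < 2 ^ e → (k : ℕ) →
    x (n + k * (2 ^ e * 4)) ≡ x n
  periodicAt e (even m) _ k = begin
    x (m * 2 + k * (2 ^ e * 4))     ≡⟨ cong x (regroup m k (2 ^ e)) ⟩
    x ((m + k * 2 ^ e * 2) * 2)     ≡⟨ x-even (m + k * 2 ^ e * 2) ⟩
    parity (m + k * 2 ^ e * 2)      ≡⟨ parity-periodic m (k * 2 ^ e) ⟩
    parity m                        ≡⟨ sym (x-even m) ⟩
    x (m * 2)                       ∎
    where
    regroup : ∀ m k p → m * 2 + k * (p * 4) ≡ (m + k * p * 2) * 2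
    regroup = solve-∀
  periodicAt zero    (odd m) (s≤s ()) k
  periodicAt (suc e) (odd m) 1+2m<2^e k = begin
    x (suc (m * 2) + k * (2 * 2 ^ e * 4))  ≡⟨ cong x (regroup m k (2 ^ e)) ⟩
    x (suc ((m + k * (2 ^ e * 4)) * 2))    ≡⟨ x-odd (m + k * (2 ^ e * 4)) ⟩
    flip (x (m + k * (2 ^ e * 4)))         ≡⟨ cong flip (periodicAt e (halfView m) (half-< m (2 ^ e) 1+2m<2^e) k) ⟩
    flip (x m)                             ≡⟨ sym (x-odd m) ⟩
    x (suc (m * 2))                        ∎
    where
    regroup : ∀ m k p → suc (m * 2) + k * (2 * p * 4) ≡ suc ((m + k * (p * 4)) * 2)
    regroup = solve-∀

x-toeplitz : ToeplitzType x
x-toeplitz N = 2 ^ N * 4 , *-monoˡ-< 4 (m^n>0 2 N) ,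
  λ n n<N → x-periodic N n (<-trans n<N (n<2^n N))

x-almostPeriodic : AlmostPeriodic x
x-almostPeriodic = toeplitz⇒almostPeriodic x x-toeplitz

-- Discrepancy

sign : Fin 2 → ℤ
sign zero       = ℤ.+ 1
sign (suc zero) = ℤ.- ℤ.+ 1

sign-flip : (a : Fin 2) → sign (flip a) ≡ ℤ.- sign a
sign-flip zero       = refl
sign-flip (suc zero) = refl

disc : (ℕ → Fin 2) → ℕ → ℤ
disc y N = ℤ.+ count y zero N ℤ.- ℤ.+ count y (suc zero) N

δ : Fin 2 → Fin 2 → ℕ
δ b a with b ≟ a
... | yes _ = 1
... | no _  = 0

count-suc : (y : ℕ → Fin 2) (a : Fin 2) (N : ℕ) → count y a (suc N) ≡ δ (y N) a + count y a N
count-suc y a N with y N ≟ a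
... | yes _ = refl
... | no _  = refl

sign-δ : (b : Fin 2) → sign b ≡ ℤ.+ δ b zero ℤ.- ℤ.+ δ b (suc zero)
sign-δ zero       = refl
sign-δ (suc zero) = refl

disc-suc : (y : ℕ → Fin 2) (N : ℕ) → disc y (suc N) ≡ sign (y N) ℤ.+ disc y N
disc-suc y N = begin
  disc y (suc N)
    ≡⟨ cong₂ (λ c₀ c₁ → ℤ.+ c₀ ℤ.- ℤ.+ c₁) (count-suc y zero N) (count-suc y (suc zero) N) ⟩
  (ℤ.+ δ (y N) zero ℤ.+ ℤ.+ count y zero N) ℤ.- (ℤ.+ δ (y N) (suc zero) ℤ.+ ℤ.+ count y (suc zero) N)
    ≡⟨ regroup (ℤ.+ δ (y N) zero) (ℤ.+ count y zero N) (ℤ.+ δ (y N) (suc zero)) (ℤ.+ count y (suc zero) N) ⟩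
  (ℤ.+ δ (y N) zero ℤ.- ℤ.+ δ (y N) (suc zero)) ℤ.+ disc y N
    ≡⟨ cong (ℤ._+ disc y N) (sym (sign-δ (y N))) ⟩
  sign (y N) ℤ.+ disc y N ∎
  where
  regroup : ∀ d₀ c₀ d₁ c₁ → (d₀ ℤ.+ c₀) ℤ.- (d₁ ℤ.+ c₁) ≡ (d₀ ℤ.- d₁) ℤ.+ (c₀ ℤ.- c₁)
  regroup = solve-∀ℤ

disc-interleave : (y g h : ℕ → Fin 2) →
  ((m : ℕ) → y (m * 2) ≡ g m) → ((m : ℕ) → y (suc (m * 2)) ≡ h m) →
  (N : ℕ) → disc y (N * 2) ≡ disc g N ℤ.+ disc h N
disc-interleave y g h y-even y-odd zero = refl
disc-interleave y g h y-even y-odd (suc N) = begin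
  disc y (suc (suc (N * 2)))
    ≡⟨ trans (disc-suc y _) (cong (ℤ._+_ (sign (y (suc (N * 2))))) (disc-suc y _)) ⟩
  sign (y (suc (N * 2))) ℤ.+ (sign (y (N * 2)) ℤ.+ disc y (N * 2))
    ≡⟨ cong₂ (λ a b → sign a ℤ.+ (sign b ℤ.+ disc y (N * 2))) (y-odd N) (y-even N) ⟩
  sign (h N) ℤ.+ (sign (g N) ℤ.+ disc y (N * 2))
    ≡⟨ cong (λ d → sign (h N) ℤ.+ (sign (g N) ℤ.+ d)) (disc-interleave y g h y-even y-odd N) ⟩
  sign (h N) ℤ.+ (sign (g N) ℤ.+ (disc g N ℤ.+ disc h N))
    ≡⟨ shuffle (sign (h N)) (sign (g N)) (disc g N) (disc h N) ⟩
  (sign (g N) ℤ.+ disc g N) ℤ.+ (sign (h N) ℤ.+ disc h N)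
    ≡⟨ sym (cong₂ ℤ._+_ (disc-suc g N) (disc-suc h N)) ⟩
  disc g (suc N) ℤ.+ disc h (suc N) ∎
  where
  shuffle : ∀ s t a b → s ℤ.+ (t ℤ.+ (a ℤ.+ b)) ≡ (t ℤ.+ a) ℤ.+ (s ℤ.+ b)
  shuffle = solve-∀ℤ

disc-flip : (y : ℕ → Fin 2) (N : ℕ) → disc (flip ∘ y) N ≡ ℤ.- disc y N
disc-flip y zero    = refl
disc-flip y (suc N) = begin
  disc (flip ∘ y) (suc N)                 ≡⟨ disc-suc (flip ∘ y) N ⟩
  sign (flip (y N)) ℤ.+ disc (flip ∘ y) N ≡⟨ cong₂ ℤ._+_ (sign-flip (y N)) (disc-flip y N) ⟩
  ℤ.- sign (y N) ℤ.+ ℤ.- disc y N         ≡⟨ negSum (sign (y N)) (disc y N) ⟩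
  ℤ.- (sign (y N) ℤ.+ disc y N)           ≡⟨ cong ℤ.-_ (sym (disc-suc y N)) ⟩
  ℤ.- disc y (suc N)                      ∎
  where
  negSum : ∀ a b → ℤ.- a ℤ.+ ℤ.- b ≡ ℤ.- (a ℤ.+ b)
  negSum = solve-∀ℤ

disc-parity-even : (m : ℕ) → disc parity (m * 2) ≡ ℤ.+ 0
disc-parity-odd  : (m : ℕ) → disc parity (suc (m * 2)) ≡ ℤ.+ 1

disc-parity-even zero    = refl
disc-parity-even (suc m) = trans (disc-suc parity (suc (m * 2)))
  (cong₂ (λ a d → sign a ℤ.+ d) (parity-odd m) (disc-parity-odd m))

disc-parity-odd m = trans (disc-suc parity (m * 2))
  (cong₂ (λ a d → sign a ℤ.+ d) (parity-even m) (disc-parity-even m))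

difference : (a b n : ℕ) → ℤ.+ a ℤ.- ℤ.+ b ≡ ℤ.+ n → a ≡ b + n
difference a b n a-b≡n = ℤₚ.+-injective (begin
  ℤ.+ a                            ≡⟨ subtractAdd (ℤ.+ a) (ℤ.+ b) ⟩
  (ℤ.+ a ℤ.- ℤ.+ b) ℤ.+ ℤ.+ b      ≡⟨ cong (ℤ._+ ℤ.+ b) a-b≡n ⟩
  ℤ.+ (n + b)                      ≡⟨ cong ℤ.+_ (+-comm n b) ⟩
  ℤ.+ (b + n)                      ∎)
  where
  subtractAdd : ∀ a b → a ≡ (a ℤ.- b) ℤ.+ b
  subtractAdd = solve-∀ℤ

zeros-ahead : (y : ℕ → Fin 2) (N : ℕ) {n : ℕ} →
  disc y N ≡ ℤ.+ n → count y zero N ≡ count y (suc zero) N + n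
zeros-ahead y N = difference _ _ _

ones-ahead : (y : ℕ → Fin 2) (N : ℕ) {n : ℕ} →
  disc y N ≡ ℤ.- ℤ.+ n → count y (suc zero) N ≡ count y zero N + n
ones-ahead y N {n} d≡-n = difference _ _ _ (begin
  ℤ.+ count y (suc zero) N ℤ.- ℤ.+ count y zero N  ≡⟨ swap (ℤ.+ count y zero N) (ℤ.+ count y (suc zero) N) ⟩
  ℤ.- disc y N                                     ≡⟨ cong ℤ.-_ d≡-n ⟩
  ℤ.- ℤ.- ℤ.+ n                                    ≡⟨ ℤₚ.neg-involutive (ℤ.+ n) ⟩
  ℤ.+ n                                            ∎)
  where
  swap : ∀ a b → b ℤ.- a ≡ ℤ.- (a ℤ.- b)
  swap = solve-∀ℤ

-- D(2N) = [N odd] - D(N): the even positions of x spell parity, the odd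
-- positions spell the complement of x.
disc-x-double : (N : ℕ) → disc x (N * 2) ≡ disc parity N ℤ.- disc x N
disc-x-double N = trans (disc-interleave x parity (flip ∘ x) x-even x-odd N)
  (cong (ℤ._+_ (disc parity N)) (disc-flip x N))

disc-x-step : (m : ℕ) → disc x (suc (m * 2)) ≡ sign (parity m) ℤ.+ disc x (m * 2)
disc-x-step m = trans (disc-suc x (m * 2)) (cong (λ a → sign a ℤ.+ disc x (m * 2)) (x-even m))

negate : (M : ℕ) {d : ℤ} → disc x (M * 2) ≡ d → disc x (M * 2 * 2) ≡ ℤ.- d
negate M {d} D≡d = begin
  disc x (M * 2 * 2)                       ≡⟨ disc-x-double (M * 2) ⟩
  disc parity (M * 2) ℤ.- disc x (M * 2)   ≡⟨ cong₂ ℤ._-_ (disc-parity-even M) D≡d ⟩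
  ℤ.+ 0 ℤ.- d                              ≡⟨ ℤₚ.+-identityˡ (ℤ.- d) ⟩
  ℤ.- d                                    ∎

reflect : (L : ℕ) {e : ℤ} → disc x (suc (L * 2)) ≡ e → disc x (suc (L * 2) * 2) ≡ ℤ.+ 1 ℤ.- e
reflect L D≡e = trans (disc-x-double (suc (L * 2)))
  (cong₂ ℤ._-_ (disc-parity-odd L) D≡e)

rise : (M : ℕ) {d : ℤ} → disc x (M * 2) ≡ d → disc x (suc (M * 2 * 2 * 2)) ≡ ℤ.+ 1 ℤ.+ d
rise M {d} D≡d = begin
  disc x (suc (M * 2 * 2 * 2))                         ≡⟨ disc-x-step (M * 2 * 2) ⟩
  sign (parity (M * 2 * 2)) ℤ.+ disc x (M * 2 * 2 * 2) ≡⟨ cong₂ (λ a d → sign a ℤ.+ d) (parity-even (M * 2)) (negate (M * 2) (negate M D≡d)) ⟩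
  ℤ.+ 1 ℤ.+ ℤ.- ℤ.- d                                  ≡⟨ cong (ℤ._+_ (ℤ.+ 1)) (ℤₚ.neg-involutive d) ⟩
  ℤ.+ 1 ℤ.+ d                                          ∎

fall : (K : ℕ) {e : ℤ} → disc x (suc (K * 2)) ≡ e → disc x (suc (suc (K * 2) * 2)) ≡ ℤ.- e
fall K {e} D≡e = begin
  disc x (suc (suc (K * 2) * 2))                                ≡⟨ disc-x-step (suc (K * 2)) ⟩
  sign (parity (suc (K * 2))) ℤ.+ disc x (suc (K * 2) * 2)      ≡⟨ cong₂ (λ a d → sign a ℤ.+ d) (parity-odd K) (reflect K D≡e) ⟩
  ℤ.- ℤ.+ 1 ℤ.+ (ℤ.+ 1 ℤ.- e)                                   ≡⟨ cancel e ⟩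
  ℤ.- e                                                         ∎
  where
  cancel : ∀ e → ℤ.- ℤ.+ 1 ℤ.+ (ℤ.+ 1 ℤ.- e) ≡ ℤ.- e
  cancel = solve-∀ℤ

-- 2 * (1 + summit k) is a prefix length with discrepancy 2k; the next one is
-- reached by rise, fall and reflect.
summit : ℕ → ℕ
summit zero    = 0
summit (suc k) = suc (suc (summit k) * 2 * 2 * 2) * 2

disc-summit : (k : ℕ) → disc x (suc (summit k) * 2) ≡ ℤ.+ (k * 2)
disc-summit zero    = refl
disc-summit (suc k) =
  trans (reflect (suc (suc (summit k) * 2 * 2 * 2))
                 (fall (suc (summit k) * 2 * 2) (rise (suc (summit k)) (disc-summit k))))
        (cong (ℤ._+_ (ℤ.+ 1)) (ℤₚ.neg-involutive (ℤ.+ suc (k * 2))))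

proposition5 : Σ (ℕ → Fin 2) λ x → AlmostPeriodic x
    × ((n : ℕ) → ∃ λ i → count x zero (suc i) ≡ count x (suc zero) (suc i) + n)
    × ((n : ℕ) → ∃ λ i → count x (suc zero) (suc i) ≡ count x zero (suc i) + n)
proposition5 = x , x-almostPeriodic , zerosLead , onesLead
  where
  -- Lead 2k at length 2(1 + summit k); lead 2k+1 one rise later.
  zerosLead : (n : ℕ) → ∃ λ i → count x zero (suc i) ≡ count x (suc zero) (suc i) + n
  zerosLead n with halfView n
  ... | even k = suc (summit k * 2) ,
    zeros-ahead x (suc (summit k) * 2) (disc-summit k)
  ... | odd k  = suc (summit k) * 2 * 2 * 2 ,
    zeros-ahead x (suc (suc (summit k) * 2 * 2 * 2)) (rise (suc (summit k)) (disc-summit k))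

  -- Deficit 2k by negating the lead 2k; deficit 2k+1 by a fall after a rise.
  onesLead : (n : ℕ) → ∃ λ i → count x (suc zero) (suc i) ≡ count x zero (suc i) + n
  onesLead n with halfView n
  ... | even k = suc (suc (summit k * 2) * 2) ,
    ones-ahead x (suc (summit k) * 2 * 2) (negate (suc (summit k)) (disc-summit k))
  ... | odd k  = suc (suc (summit k) * 2 * 2 * 2) * 2 ,
    ones-ahead x (suc (suc (suc (summit k) * 2 * 2 * 2) * 2))
      (fall (suc (summit k) * 2 * 2) (rise (suc (summit k)) (disc-summit k)))
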